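{- If there exist a generalized Hadamard matrix $GH(g,1)$ over a finite abelian group and linked UFS Latin squares $L_{i,j}$ ($i,j\in\{1,\ldots,f\}$, $i\neq j$) of order $g+1$, then there exists a linked system of symmetric group divisible designs (indexed by $\{1,\ldots,f\}$) with parameters $(g^2(g+1),g(g+1),g+1,g^2,g,g+1)$ and constants $(\sigma,\tau)=(2g,g)$.
   Context: $I_n,J_n$ denote the identity and all-ones matrices of order $n$; $\otimes$ is the Kronecker product. Let $G$ be an additively written abelian group of order $g$. A generalized Hadamard matrix $GH(g,\lambda)$ over $G$ is a square matrix $H=(h_{ij})$ of order $g\lambda$ with entries in $G$ such that for all distinct rows $i,k$ the multiset $\{h_{ij}-h_{kj}:1\le j\le g\lambda\}$ contains each element of $G$ exactly $\lambda$ times. A $v\times v$ $(0,1)$-matrix $A$ ($v=mn$) is the incidence matrix of a symmetric group divisible design with parameters $(v,k,m,n,\lambda_1,\lambda_2)$ if $AA^\top=A^\top A=kI_v+\lambda_1(I_m\otimes J_n-I_v)+\lambda_2(J_v-I_m\otimes J_n)$. A linked system of such designs with constants $\sigma,\tau$ is a family of such incidence matrices $A_{i,j}$ ($i\neq j$ in $\{1,\ldots,f\}$) with $A_{i,j}^\top=A_{j,i}$ and $A_{i,j}A_{j,l}=\sigma A_{i,l}+\tau(J_v-A_{i,l})$ for all pairwise distinct $i,j,l$. Two Latin squares $L,L'$ of order $N$ on the same symbol set are UFS if for every row $i$ of $L$ and every row $j$ of $L'$ there is exactly one column $a$ with $L(i,a)=L'(j,a)$; then the square obtained from $L$ and $L'$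 (in this order) is the $N\times N$ array whose $(i,j)$-entry is $L(i,a)=L'(j,a)$ for this unique $a$. For $f\ge3$, Latin squares $L_{i,j}$ ($i\ne j$) on the same symbol set are linked UFS Latin squares if for all pairwise distinct $i,j,k$, $L_{i,k}$ and $L_{j,k}$ are UFS and the square obtained from $L_{i,k}$ and $L_{j,k}$ equals $L_{i,j}$. -}

module Defs where

open import Data.Nat using (ℕ; zero; suc; _+_; _*_; _∸_; _≤_)
open import Data.Bool using (Bool; if_then_else_)
open import Data.Fin using (Fin)
import Data.Fin.Properties as FinP
open import Data.Product using (_×_; _,_; proj₁; proj₂)
open import Data.Sum using (_⊎_)
open import Relation.Nullary using (¬_)
open import Relation.Nullary.Decidable using (⌊_⌋)
open import Relation.Binary.PropositionalEquality using (_≡_; _≢_)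
open import Algebra.Core using (Op₁; Op₂)

count : (n : ℕ) → (Fin n → Bool) → ℕ
count zero    p = 0
count (suc n) p = (if p Fin.zero then 1 else 0) + count n (λ x → p (Fin.suc x))

eqB : ∀ {n} → Fin n → Fin n → Bool
eqB x y = ⌊ x FinP.≟ y ⌋

sumFin : (n : ℕ) → (Fin n → ℕ) → ℕ
sumFin zero    f = 0
sumFin (suc n) f = f Fin.zero + sumFin n (λ x → f (Fin.suc x))

-- Generalized Hadamard matrix GH(g,1) over an abelian group G on Fin g
-- (order gλ = g); for distinct rows i,k every x ∈ G occurs exactly once
-- among the differences h_ij - h_kj.

IsGH1 : (g : ℕ) → Op₂ (Fin g) → Op₁ (Fin g) → (Fin g → Fin g → Fin g) → Set
IsGH1 g _+_ -_ H =
  ∀ i k → i ≢ k → ∀ x → count g (λ j → eqB (H i j + (- H k j)) x) ≡ 1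

Square : ℕ → Set
Square N = Fin N → Fin N → Fin N

IsLatin : (N : ℕ) → Square N → Set
IsLatin N L =
  (∀ i s → count N (λ a → eqB (L i a) s) ≡ 1) ×
  (∀ a s → count N (λ i → eqB (L i a) s) ≡ 1)

UFS : (N : ℕ) → Square N → Square N → Set
UFS N L L' = ∀ i j → count N (λ a → eqB (L i a) (L' j a)) ≡ 1

Obtained : (N : ℕ) → Square N → Square N → Square N → Set
Obtained N L L' M = ∀ i j a → L i a ≡ L' j a → M i j ≡ L i a

Distinct3 : ∀ {f} → Fin f → Fin f → Fin f → Set
Distinct3 i j k = i ≢ j × j ≢ k × i ≢ k

-- linked UFS Latin squares L_{i,j} (i ≠ j in Fin f), f ≥ 3
-- (values L i i are irrelevant)
LinkedUFS : (f N : ℕ) → (Fin f → Fin f → Square N) → Set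
LinkedUFS f N L =
  3 ≤ f ×
  (∀ i j → i ≢ j → IsLatin N (L i j)) ×
  (∀ i j k → Distinct3 i j k →
     UFS N (L i k) (L j k) × Obtained N (L i k) (L j k) (L i j))

-- Points are Fin m × Fin n
-- (v = mn), the pair (a , b) standing for row/column index a·n + b, so that
-- the (p,q) entry of I_m ⊗ J_n is 1 iff proj₁ p ≡ proj₁ q.

Pt : ℕ → ℕ → Set
Pt m n = Fin m × Fin n

Mat : ℕ → ℕ → Set
Mat m n = Pt m n → Pt m n → ℕ

sumPt : (m n : ℕ) → (Pt m n → ℕ) → ℕ
sumPt m n h = sumFin m (λ a → sumFin n (λ b → h (a , b)))

mul : ∀ {m n} → Mat m n → Mat m n → Mat m n
mul {m} {n} A B p q = sumPt m n (λ r → A p r * B r q)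

transpose : ∀ {m n} → Mat m n → Mat m n
transpose A p q = A q p

ZeroOne : ∀ {m n} → Mat m n → Set
ZeroOne A = ∀ p q → A p q ≡ 0 ⊎ A p q ≡ 1

ind : Bool → ℕ
ind b = if b then 1 else 0

Iv : ∀ {m n} → Mat m n
Iv p q = ind (eqB (proj₁ p) (proj₁ q)) * ind (eqB (proj₂ p) (proj₂ q))

IJ : ∀ {m n} → Mat m n
IJ p q = ind (eqB (proj₁ p) (proj₁ q))

GDDRhs : ∀ {m n} → ℕ → ℕ → ℕ → Mat m n
GDDRhs k λ₁ λ₂ p q =
  k * Iv p q + λ₁ * (IJ p q ∸ Iv p q) + λ₂ * (1 ∸ IJ p q)

IsSGDD : (m n k λ₁ λ₂ : ℕ) → Mat m n → Set
IsSGDD m n k λ₁ λ₂ A =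
  ZeroOne A ×
  (∀ p q → mul A (transpose A) p q ≡ GDDRhs k λ₁ λ₂ p q) ×
  (∀ p q → mul (transpose A) A p q ≡ GDDRhs k λ₁ λ₂ p q)

-- linked system of symmetric GDDs indexed by Fin f, constants σ, τ
-- (values A i i are irrelevant)
LinkedSGDD : (f m n k λ₁ λ₂ σ τ : ℕ) → (Fin f → Fin f → Mat m n) → Set
LinkedSGDD f m n k λ₁ λ₂ σ τ A =
  (∀ i j → i ≢ j → IsSGDD m n k λ₁ λ₂ (A i j)) ×
  (∀ i j → i ≢ j → ∀ p q → transpose (A i j) p q ≡ A j i p q) ×
  (∀ i j l → Distinct3 i j l → ∀ p q →
     mul (A i j) (A j l) p q ≡ σ * A i l p q + τ * (1 ∸ A i l p q))

-- A GH(g,1) H over G gives an affine plane of order g on G × G: its g + 1 parallel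
-- classes are the vertical lines a = const and, for each row r of H, the lines
-- b − H r a = const.  Two classes meet in exactly one point because differences of
-- distinct rows of H take every value once, and two points lie on exactly one common
-- line because the transpose of a GH(g,1) is again a GH(g,1).  Let C_s be the
-- point–point incidence matrix of class s, so that C_s C_s = g C_s, C_s C_t = J for
-- s ≠ t and Σ_s C_s = J + g I, and let A_{i,j} be the block matrix with block
-- C_{L_{i,j}(x,z)} at (x,z).  Rows and columns of a Latin square are permutations,
-- which turns A Aᵀ and Aᵀ A into g(g+1) I + g (I⊗J − I) + (g+1) (J − I⊗J).  In
-- A_{i,j} A_{j,l} the block (x,z) is Σ_y C_{L_{i,j}(x,y)} C_{L_{j,l}(y,z)}, where the two
-- classes coincide for exactly one y, and then equal L_{i,l}(x,z); hence the block is
-- g C_{L_{i,l}(x,z)} + g J, which is 2g A_{i,l} + g (J − A_{i,l}) entrywise.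

module Submission where

open import Defs
open import Data.Nat using (ℕ; zero; suc; _+_; _*_; _∸_; _≤_; z≤n; s≤s)
open import Data.Nat.Properties
open import Data.Nat.Tactic.RingSolver using (solve-∀)
open import Data.Bool using (Bool; true; false; _∧_)
open import Data.Bool.Properties using (∧-identityʳ; ∧-idem; ∧-comm; not-¬; ¬-not)
open import Data.Fin using (Fin; zero; suc; _↑ˡ_; _↑ʳ_; combine; remQuot)
import Data.Fin.Properties as Fin
open import Data.Product using (_×_; _,_; proj₁; proj₂; ∃; swap; uncurry)
open import Data.Sum using (_⊎_; inj₁; inj₂)
open import Data.Empty using (⊥-elim)
open import Function.Bundles using (_⇔_; mk⇔; Equivalence)
open import Relation.Nullary using (Dec; yes; no)
open import Relation.Binary.PropositionalEquality
open import Algebra.Core using (Op₁; Op₂)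
open import Algebra.Structures using (IsAbelianGroup)
open import Algebra.Bundles using (AbelianGroup)
import Algebra.Properties.AbelianGroup as AbelianGroupProperties
import Algebra.Properties.CommutativeSemigroup as CommutativeSemigroupProperties
open import Level using (0ℓ)
open ≡-Reasoning

eqB-≡ : ∀ {n} {x y : Fin n} → x ≡ y → eqB x y ≡ true
eqB-≡ {x = x} {y} x≡y with x Fin.≟ y
... | yes _   = refl
... | no x≢y = ⊥-elim (x≢y x≡y)

eqB-≢ : ∀ {n} {x y : Fin n} → x ≢ y → eqB x y ≡ false
eqB-≢ {x = x} {y} x≢y with x Fin.≟ y
... | yes x≡y = ⊥-elim (x≢y x≡y)
... | no _    = refl

eqB-refl : ∀ {n} (x : Fin n) → eqB x x ≡ true
eqB-refl x = eqB-≡ refl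

eqB-true : ∀ {n} {x y : Fin n} → eqB x y ≡ true → x ≡ y
eqB-true {x = x} {y} e with x Fin.≟ y
... | yes x≡y = x≡y
eqB-true () | no _

eqB-cong : ∀ {m n} {x y : Fin m} {x' y' : Fin n} → (x ≡ y ⇔ x' ≡ y') → eqB x y ≡ eqB x' y'
eqB-cong {x = x} {y} x≡y⇔x'≡y' with x Fin.≟ y
... | yes x≡y = sym (eqB-≡ (Equivalence.to x≡y⇔x'≡y' x≡y))
... | no x≢y  = sym (eqB-≢ (λ x'≡y' → x≢y (Equivalence.from x≡y⇔x'≡y' x'≡y')))

eqB-sym : ∀ {n} (x y : Fin n) → eqB x y ≡ eqB y x
eqB-sym x y = eqB-cong (mk⇔ sym sym)

ind-∧ : ∀ b c → ind b * ind c ≡ ind (b ∧ c)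
ind-∧ true  c = +-identityʳ (ind c)
ind-∧ false c = refl

eqB-∧-≢ : ∀ {n} (w : Fin n) {x y} → x ≢ y → eqB w x ∧ eqB w y ≡ false
eqB-∧-≢ w {x} {y} x≢y with eqB w x in w≡x
... | true  = eqB-≢ (λ w≡y → x≢y (trans (sym (eqB-true w≡x)) w≡y))
... | false = refl

ind-01 : ∀ b → ind b ≡ 0 ⊎ ind b ≡ 1
ind-01 true  = inj₂ refl
ind-01 false = inj₁ refl

-- Finite sums and counts

sum-cong : ∀ n {f h : Fin n → ℕ} → (∀ x → f x ≡ h x) → sumFin n f ≡ sumFin n h
sum-cong zero    f≗h = refl
sum-cong (suc n) f≗h = cong₂ _+_ (f≗h zero) (sum-cong n (λ x → f≗h (suc x)))

sum-const : ∀ n k → sumFin n (λ _ → k) ≡ n * k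
sum-const zero    k = refl
sum-const (suc n) k = cong (k +_) (sum-const n k)

sum-+ : ∀ n (f h : Fin n → ℕ) → sumFin n (λ x → f x + h x) ≡ sumFin n f + sumFin n h
sum-+ zero    f h = refl
sum-+ (suc n) f h = begin
  f zero + h zero + sumFin n (λ x → f (suc x) + h (suc x))
    ≡⟨ cong (f zero + h zero +_) (sum-+ n (λ x → f (suc x)) (λ x → h (suc x))) ⟩
  f zero + h zero + (sumFin n (λ x → f (suc x)) + sumFin n (λ x → h (suc x)))
    ≡⟨ +-comm-middle (f zero) (h zero) _ _ ⟩
  f zero + sumFin n (λ x → f (suc x)) + (h zero + sumFin n (λ x → h (suc x))) ∎
  where
  +-comm-middle : ∀ a b c d → a + b + (c + d) ≡ a + c + (b + d)
  +-comm-middle = solve-∀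

sum-*ˡ : ∀ n k (f : Fin n → ℕ) → sumFin n (λ x → k * f x) ≡ k * sumFin n f
sum-*ˡ zero    k f = sym (*-zeroʳ k)
sum-*ˡ (suc n) k f = begin
  k * f zero + sumFin n (λ x → k * f (suc x)) ≡⟨ cong (k * f zero +_) (sum-*ˡ n k (λ x → f (suc x))) ⟩
  k * f zero + k * sumFin n (λ x → f (suc x)) ≡⟨ *-distribˡ-+ k (f zero) _ ⟨
  k * (f zero + sumFin n (λ x → f (suc x)))   ∎

sum-comm : ∀ m n (f : Fin m → Fin n → ℕ) →
  sumFin m (λ x → sumFin n (f x)) ≡ sumFin n (λ y → sumFin m (λ x → f x y))
sum-comm zero    n f = sym (trans (sum-const n 0) (*-zeroʳ n))
sum-comm (suc m) n f = begin
  sumFin n (f zero) + sumFin m (λ x → sumFin n (f (suc x)))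
    ≡⟨ cong (sumFin n (f zero) +_) (sum-comm m n (λ x → f (suc x))) ⟩
  sumFin n (f zero) + sumFin n (λ y → sumFin m (λ x → f (suc x) y))
    ≡⟨ sum-+ n (f zero) _ ⟨
  sumFin n (λ y → f zero y + sumFin m (λ x → f (suc x) y)) ∎

sum-↑ : ∀ m n (h : Fin (m + n) → ℕ) →
  sumFin (m + n) h ≡ sumFin m (λ x → h (x ↑ˡ n)) + sumFin n (λ y → h (m ↑ʳ y))
sum-↑ zero    n h = refl
sum-↑ (suc m) n h = trans (cong (h zero +_) (sum-↑ m n (λ x → h (suc x))))
  (sym (+-assoc (h zero) _ _))

sum-combine : ∀ m n (h : Fin (m * n) → ℕ) →
  sumFin (m * n) h ≡ sumFin m (λ x → sumFin n (λ y → h (combine x y)))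
sum-combine zero    n h = refl
sum-combine (suc m) n h = trans (sum-↑ n (m * n) h)
  (cong (sumFin n (λ y → h (y ↑ˡ (m * n))) +_) (sum-combine m n (λ z → h (n ↑ʳ z))))

sum-δ : ∀ n (x : Fin n) (f : Fin n → ℕ) → sumFin n (λ y → ind (eqB y x) * f y) ≡ f x
sum-δ (suc n) zero f = begin
  ind (eqB zero (zero {n})) * f zero + sumFin n (λ y → ind (eqB (suc y) zero) * f (suc y))
    ≡⟨ cong₂ (λ b s → ind b * f zero + s) (eqB-refl (zero {n})) (sum-cong n (λ y → cong (λ b → ind b * f (suc y)) (eqB-≢ {x = suc y} {zero} λ ()))) ⟩
  1 * f zero + sumFin n (λ _ → 0)  ≡⟨ cong₂ _+_ (*-identityˡ (f zero)) (trans (sum-const n 0) (*-zeroʳ n)) ⟩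
  f zero + 0                       ≡⟨ +-identityʳ (f zero) ⟩
  f zero                           ∎
sum-δ (suc n) (suc x) f = begin
  ind (eqB zero (suc x)) * f zero + sumFin n (λ y → ind (eqB (suc y) (suc x)) * f (suc y))
    ≡⟨ cong₂ (λ b s → ind b * f zero + s) (eqB-≢ {x = zero} {suc x} λ ())
         (sum-cong n (λ y → cong (λ b → ind b * f (suc y)) (eqB-cong {x = suc y} {suc x} (mk⇔ Fin.suc-injective (cong suc))))) ⟩
  sumFin n (λ y → ind (eqB y x) * f (suc y)) ≡⟨ sum-δ n x (λ y → f (suc y)) ⟩
  f (suc x)                                  ∎

sum-ones : ∀ n {f : Fin n → ℕ} → (∀ x → f x ≡ 1) → sumFin n f ≡ n
sum-ones n f≗1 = trans (sum-cong n f≗1) (trans (sum-const n 1) (*-identityʳ n))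

sum-≤ : ∀ n {f : Fin n → ℕ} → (∀ x → f x ≤ 1) → sumFin n f ≤ n
sum-≤ zero    f≤1 = z≤n
sum-≤ (suc n) f≤1 = +-mono-≤ (f≤1 zero) (sum-≤ n (λ x → f≤1 (suc x)))

sum-≤1-saturated : ∀ n (f : Fin n → ℕ) → (∀ x → f x ≤ 1) → sumFin n f ≡ n → ∀ x → f x ≡ 1
sum-≤1-saturated (suc n) f f≤1 Σf≡n x with f zero in f₀≡ | f≤1 zero
... | 0 | _ = ⊥-elim (<⇒≱ (n<1+n n) (subst (_≤ n) Σf≡n (sum-≤ n (λ y → f≤1 (suc y)))))
sum-≤1-saturated (suc n) f f≤1 Σf≡n zero    | 1 | _ = f₀≡
sum-≤1-saturated (suc n) f f≤1 Σf≡n (suc x) | 1 | _ =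
  sum-≤1-saturated n (λ y → f (suc y)) (λ y → f≤1 (suc y)) (suc-injective Σf≡n) x
... | suc (suc _) | s≤s ()

count≡sum : ∀ n (b : Fin n → Bool) → count n b ≡ sumFin n (λ x → ind (b x))
count≡sum zero    b = refl
count≡sum (suc n) b = cong (ind (b zero) +_) (count≡sum n (λ x → b (suc x)))

count-cong : ∀ n {b c : Fin n → Bool} → (∀ x → b x ≡ c x) → count n b ≡ count n c
count-cong n b≗c = trans (count≡sum n _) (trans (sum-cong n (λ x → cong ind (b≗c x))) (sym (count≡sum n _)))

count-true : ∀ n → count n (λ _ → true) ≡ n
count-true n = trans (count≡sum n _) (sum-ones n (λ _ → refl))

count-false : ∀ n {b : Fin n → Bool} → (∀ x → b x ≡ false) → count n b ≡ 0
count-false zero    b≗false = refl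
count-false (suc n) b≗false rewrite b≗false zero = count-false n (λ x → b≗false (suc x))

count≡0⇒false : ∀ n (b : Fin n → Bool) → count n b ≡ 0 → ∀ x → b x ≡ false
count≡0⇒false (suc n) b #b≡0 x with b zero in b₀≡
count≡0⇒false (suc n) b ()   x       | true
count≡0⇒false (suc n) b #b≡0 zero    | false = b₀≡
count≡0⇒false (suc n) b #b≡0 (suc x) | false = count≡0⇒false n (λ y → b (suc y)) #b≡0 x

count-∧ˡ : ∀ n c (b : Fin n → Bool) → count n (λ x → c ∧ b x) ≡ ind c * count n b
count-∧ˡ n true  b = sym (+-identityʳ (count n b))
count-∧ˡ n false b = count-false n (λ _ → refl)

count-δ : ∀ n (x : Fin n) (b : Fin n → Bool) → count n (λ y → eqB y x ∧ b y) ≡ ind (b x)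
count-δ n x b = begin
  count n (λ y → eqB y x ∧ b y)               ≡⟨ count≡sum n _ ⟩
  sumFin n (λ y → ind (eqB y x ∧ b y))        ≡⟨ sum-cong n (λ y → ind-∧ (eqB y x) (b y)) ⟨
  sumFin n (λ y → ind (eqB y x) * ind (b y))  ≡⟨ sum-δ n x (λ y → ind (b y)) ⟩
  ind (b x)                                   ∎

count-≡ : ∀ n (x : Fin n) → count n (λ y → eqB y x) ≡ 1
count-≡ n x = trans (count-cong n (λ y → sym (∧-identityʳ (eqB y x)))) (count-δ n x (λ _ → true))

only-head : ∀ {n} (b : Fin (suc n) → Bool) → count (suc n) b ≡ 1 → b zero ≡ true →
  ∀ x → b (suc x) ≡ false
only-head {n} b #b≡1 b₀ = count≡0⇒false n (λ x → b (suc x))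
  (suc-injective (trans (cong (λ c → ind c + count n (λ x → b (suc x))) (sym b₀)) #b≡1))

count-witness : ∀ n (b : Fin n → Bool) → count n b ≡ 1 → ∃ λ x → b x ≡ true
count-witness (suc n) b #b≡1 with b zero in b₀≡
... | true  = zero , b₀≡
... | false = let x , bx = count-witness n (λ y → b (suc y)) #b≡1 in suc x , bx

count-unique : ∀ n (b : Fin n → Bool) → count n b ≡ 1 →
  ∀ {x y} → b x ≡ true → b y ≡ true → x ≡ y
count-unique (suc n) b #b≡1 {zero}  {zero}  _   _   = refl
count-unique (suc n) b #b≡1 {zero}  {suc y} b₀ b-y = ⊥-elim (not-¬ (only-head b #b≡1 b₀ y) b-y)
count-unique (suc n) b #b≡1 {suc x} {zero}  b-x b₀ = ⊥-elim (not-¬ (only-head b #b≡1 b₀ x) b-x)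
count-unique (suc n) b #b≡1 {suc x} {suc y} b-x b-y with b zero in b₀
... | true  = ⊥-elim (not-¬ (count≡0⇒false n _ (suc-injective #b≡1) x) b-x)
... | false = cong suc (count-unique n (λ z → b (suc z)) #b≡1 b-x b-y)

count-≤1 : ∀ n (b : Fin n → Bool) → (∀ {x y} → b x ≡ true → b y ≡ true → x ≡ y) → count n b ≤ 1
count-≤1 zero    b unique = z≤n
count-≤1 (suc n) b unique with b zero in b₀
... | true  = ≤-reflexive (cong suc (count-false n (λ x → ¬-not (λ bx → Fin.0≢1+n (unique b₀ bx)))))
... | false = count-≤1 n (λ x → b (suc x)) (λ bx by → Fin.suc-injective (unique bx by))

sum-count-fibres : ∀ n m (b : Fin n → Bool) (σ : Fin n → Fin m) →
  sumFin m (λ y → count n (λ w → b w ∧ eqB (σ w) y)) ≡ count n b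
sum-count-fibres n m b σ = begin
  sumFin m (λ y → count n (λ w → b w ∧ eqB (σ w) y))
    ≡⟨ sum-cong m (λ y → trans (count≡sum n _) (sum-cong n (λ w → sym (ind-∧ (b w) _)))) ⟩
  sumFin m (λ y → sumFin n (λ w → ind (b w) * ind (eqB (σ w) y)))
    ≡⟨ sum-comm m n _ ⟩
  sumFin n (λ w → sumFin m (λ y → ind (b w) * ind (eqB (σ w) y)))
    ≡⟨ sum-cong n (λ w → sum-*ˡ m (ind (b w)) _) ⟩
  sumFin n (λ w → ind (b w) * sumFin m (λ y → ind (eqB (σ w) y)))
    ≡⟨ sum-cong n (λ w → cong (ind (b w) *_) (trans (sym (count≡sum m _)) fibre-σw)) ⟩
  sumFin n (λ w → ind (b w) * 1)
    ≡⟨ trans (sum-cong n (λ w → *-identityʳ (ind (b w)))) (sym (count≡sum n b)) ⟩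
  count n b ∎
  where
  fibre-σw : ∀ {w} → count m (λ y → eqB (σ w) y) ≡ 1
  fibre-σw {w} = trans (count-cong m (λ y → eqB-sym (σ w) y)) (count-≡ m (σ w))

sum-permute : ∀ n (φ : Fin n → Fin n) → (∀ s → count n (λ y → eqB (φ y) s) ≡ 1) →
  (h : Fin n → ℕ) → sumFin n (λ y → h (φ y)) ≡ sumFin n h
sum-permute n φ φ-bijective h = begin
  sumFin n (λ y → h (φ y))
    ≡⟨ sum-cong n (λ y → sym (sum-δ n (φ y) h)) ⟩
  sumFin n (λ y → sumFin n (λ s → ind (eqB s (φ y)) * h s))
    ≡⟨ sum-comm n n _ ⟩
  sumFin n (λ s → sumFin n (λ y → ind (eqB s (φ y)) * h s))
    ≡⟨ sum-cong n (λ s → trans (sum-cong n (λ y → *-comm _ (h s))) (sum-*ˡ n (h s) _)) ⟩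
  sumFin n (λ s → h s * sumFin n (λ y → ind (eqB s (φ y))))
    ≡⟨ sum-cong n (λ s → cong (h s *_) (trans (sym (count≡sum n _)) (fibre s))) ⟩
  sumFin n (λ s → h s * 1)
    ≡⟨ sum-cong n (λ s → *-identityʳ (h s)) ⟩
  sumFin n h ∎
  where
  fibre : ∀ s → count n (λ y → eqB s (φ y)) ≡ 1
  fibre s = trans (count-cong n (λ y → eqB-sym s (φ y))) (φ-bijective s)

sum-one-exception : ∀ n (b : Fin n → Bool) (f : Fin n → ℕ) K → count n b ≡ 1 →
  (∀ x → b x ≡ true → f x ≡ K) → (∀ x → b x ≡ false → f x ≡ 1) → sumFin n f + 1 ≡ K + n
sum-one-exception (suc n) b f K #b≡1 f-exc f-rest with b zero in b₀
... | true = begin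
  f zero + sumFin n (λ x → f (suc x)) + 1 ≡⟨ cong₂ (λ a c → a + c + 1) (f-exc zero b₀) rest-ones ⟩
  K + n + 1                               ≡⟨ +-assoc K n 1 ⟩
  K + (n + 1)                             ≡⟨ cong (K +_) (+-comm n 1) ⟩
  K + suc n                               ∎
  where
  rest-ones : sumFin n (λ x → f (suc x)) ≡ n
  rest-ones = sum-ones n (λ x → f-rest (suc x) (count≡0⇒false n _ (suc-injective #b≡1) x))
... | false = begin
  f zero + sumFin n (λ x → f (suc x)) + 1 ≡⟨ cong (λ a → a + sumFin n (λ x → f (suc x)) + 1) (f-rest zero b₀) ⟩
  suc (sumFin n (λ x → f (suc x)) + 1)    ≡⟨ cong suc (sum-one-exception n _ _ K #b≡1 (λ x → f-exc (suc x)) (λ x → f-rest (suc x))) ⟩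
  suc (K + n)                             ≡⟨ +-suc K n ⟨
  K + suc n                               ∎

count-remQuot : ∀ m n (b : Fin m × Fin n → Bool) →
  count (m * n) (λ w → b (remQuot n w)) ≡ sumFin m (λ x → count n (λ y → b (x , y)))
count-remQuot m n b = begin
  count (m * n) (λ w → b (remQuot n w))                              ≡⟨ count≡sum (m * n) _ ⟩
  sumFin (m * n) (λ w → ind (b (remQuot n w)))                       ≡⟨ sum-combine m n _ ⟩
  sumFin m (λ x → sumFin n (λ y → ind (b (remQuot n (combine x y))))) ≡⟨ sum-cong m (λ x → sum-cong n (λ y →
                                                                           cong (λ p → ind (b p)) (Fin.remQuot-combine x y))) ⟩
  sumFin m (λ x → sumFin n (λ y → ind (b (x , y))))                  ≡⟨ sum-cong m (λ x → count≡sum n _) ⟨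
  sumFin m (λ x → count n (λ y → b (x , y)))                         ∎

GDDRhs-diagonal : ∀ {m n} K λ₁ λ₂ (x : Fin m) (u : Fin n) → GDDRhs K λ₁ λ₂ (x , u) (x , u) ≡ K
GDDRhs-diagonal K λ₁ λ₂ x u rewrite eqB-refl x | eqB-refl u = arith K λ₁ λ₂
  where
  arith : ∀ K λ₁ λ₂ → K * 1 + λ₁ * 0 + λ₂ * 0 ≡ K
  arith = solve-∀

GDDRhs-same-group : ∀ {m n} K λ₁ λ₂ (x : Fin m) {u v : Fin n} → u ≢ v →
  GDDRhs K λ₁ λ₂ (x , u) (x , v) ≡ λ₁
GDDRhs-same-group K λ₁ λ₂ x u≢v rewrite eqB-refl x | eqB-≢ u≢v = arith K λ₁ λ₂
  where
  arith : ∀ K λ₁ λ₂ → K * 0 + λ₁ * 1 + λ₂ * 0 ≡ λ₁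
  arith = solve-∀

GDDRhs-other-group : ∀ {m n} K λ₁ λ₂ {x z : Fin m} (u v : Fin n) → x ≢ z →
  GDDRhs K λ₁ λ₂ (x , u) (z , v) ≡ λ₂
GDDRhs-other-group K λ₁ λ₂ u v x≢z rewrite eqB-≢ x≢z = arith K λ₁ λ₂
  where
  arith : ∀ K λ₁ λ₂ → K * 0 + λ₁ * 0 + λ₂ * 1 ≡ λ₂
  arith = solve-∀

-- Affine planes and the block construction

-- The k + 1 parallel classes of an affine plane of order k on the points Fin n:
-- π s u is the line of class s through u.
record IsAffinePlane (n k : ℕ) (π : Fin (suc k) → Fin n → Fin k) : Set where
  field
    lines-meet  : ∀ s t → s ≢ t → ∀ x y → count n (λ w → eqB (π s w) x ∧ eqB (π t w) y) ≡ 1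
    unique-line : ∀ u v → u ≢ v → count (suc k) (λ s → eqB (π s u) (π s v)) ≡ 1

another-index : ∀ {k} → Fin k → (s : Fin (suc k)) → ∃ λ t → s ≢ t
another-index {suc k} _ zero    = suc zero , λ ()
another-index {suc k} _ (suc s) = zero , λ ()

module AffinePlane {n k π} (plane : IsAffinePlane n k π) where
  open IsAffinePlane plane

  line-size : ∀ s x → count n (λ w → eqB (π s w) x) ≡ k
  line-size s x = begin
    count n (λ w → eqB (π s w) x)                                ≡⟨ sum-count-fibres n k _ (π t) ⟨
    sumFin k (λ y → count n (λ w → eqB (π s w) x ∧ eqB (π t w) y)) ≡⟨ sum-ones k (lines-meet s t s≢t x) ⟩
    k                                                            ∎
    where
    t = proj₁ (another-index x s)
    s≢t = proj₂ (another-index x s)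

  collinear : Fin (suc k) → Fin n → Fin n → ℕ
  collinear s u w = ind (eqB (π s w) (π s u))

  collinear-sym : ∀ s u w → collinear s u w ≡ collinear s w u
  collinear-sym s u w = cong ind (eqB-sym (π s w) (π s u))

  collinear-diagonal : ∀ u → sumFin (suc k) (λ s → collinear s u u) ≡ suc k
  collinear-diagonal u = sum-ones (suc k) (λ s → cong ind (eqB-refl (π s u)))

  collinear-off-diagonal : ∀ {u v} → u ≢ v → sumFin (suc k) (λ s → collinear s u v) ≡ 1
  collinear-off-diagonal {u} {v} u≢v =
    trans (sym (count≡sum (suc k) (λ s → eqB (π s v) (π s u)))) (unique-line v u (λ v≡u → u≢v (sym v≡u)))

  meet : Fin (suc k) → Fin (suc k) → Fin n → Fin n → ℕ
  meet s t u v = sumFin n (λ w → collinear s u w * collinear t v w)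

  meet≡count : ∀ s t u v → meet s t u v ≡ count n (λ w → eqB (π s w) (π s u) ∧ eqB (π t w) (π t v))
  meet≡count s t u v = trans (sum-cong n (λ w → ind-∧ (eqB (π s w) (π s u)) (eqB (π t w) (π t v)))) (sym (count≡sum n _))

  meet-distinct : ∀ {s t} → s ≢ t → ∀ u v → meet s t u v ≡ 1
  meet-distinct s≢t u v = trans (meet≡count _ _ u v) (lines-meet _ _ s≢t _ _)

  meet-self : ∀ s u v → meet s s u v ≡ k * collinear s u v
  meet-self s u v with π s u Fin.≟ π s v
  ... | yes πu≡πv = begin
    meet s s u v                                                 ≡⟨ meet≡count s s u v ⟩
    count n (λ w → eqB (π s w) (π s u) ∧ eqB (π s w) (π s v))   ≡⟨ count-cong n (λ w →
                                                                      cong (λ a → eqB (π s w) (π s u) ∧ eqB (π s w) a) (sym πu≡πv)) ⟩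
    count n (λ w → eqB (π s w) (π s u) ∧ eqB (π s w) (π s u))   ≡⟨ count-cong n (λ w → ∧-idem _) ⟩
    count n (λ w → eqB (π s w) (π s u))                         ≡⟨ line-size s (π s u) ⟩
    k                                                           ≡⟨ *-identityʳ k ⟨
    k * 1                                                       ≡⟨ cong (λ b → k * ind b) (eqB-≡ (sym πu≡πv)) ⟨
    k * collinear s u v                                         ∎
  ... | no πu≢πv = begin
    meet s s u v                                                 ≡⟨ meet≡count s s u v ⟩
    count n (λ w → eqB (π s w) (π s u) ∧ eqB (π s w) (π s v))   ≡⟨ count-false n (λ w → eqB-∧-≢ (π s w) πu≢πv) ⟩
    0                                                           ≡⟨ *-zeroʳ k ⟨
    k * 0                                                       ≡⟨ cong (λ b → k * ind b) (eqB-≢ (λ e → πu≢πv (sym e))) ⟨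
    k * collinear s u v                                         ∎

  block : Square (suc k) → Mat (suc k) n
  block L (x , u) (z , v) = collinear (L x z) u v

  block-zeroOne : ∀ L → ZeroOne (block L)
  block-zeroOne L (x , u) (z , v) = ind-01 _

  block-transpose : ∀ L M → (∀ x z → M x z ≡ L z x) → ∀ p q → transpose (block L) p q ≡ block M p q
  block-transpose L M M≡Lᵀ (x , u) (z , v) =
    trans (collinear-sym (L z x) v u) (cong (λ s → collinear s u v) (sym (M≡Lᵀ x z)))

  gram-latin : ∀ L → IsLatin (suc k) L → ∀ x z u v →
    sumFin (suc k) (λ y → meet (L x y) (L z y) u v) ≡ GDDRhs (k * suc k) k (suc k) (x , u) (z , v)
  gram-latin L (rows , columns) x z u v = by-group (x Fin.≟ z) (u Fin.≟ v)
    where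
    columns-differ : x ≢ z → ∀ y → L x y ≢ L z y
    columns-differ x≢z y Lxy≡Lzy =
      x≢z (count-unique (suc k) _ (columns y (L x y)) (eqB-refl (L x y)) (eqB-≡ (sym Lxy≡Lzy)))
    row-sum : sumFin (suc k) (λ y → meet (L x y) (L x y) u v) ≡ k * sumFin (suc k) (λ s → collinear s u v)
    row-sum = begin
      sumFin (suc k) (λ y → meet (L x y) (L x y) u v)    ≡⟨ sum-cong (suc k) (λ y → meet-self (L x y) u v) ⟩
      sumFin (suc k) (λ y → k * collinear (L x y) u v)   ≡⟨ sum-*ˡ (suc k) k (λ y → collinear (L x y) u v) ⟩
      k * sumFin (suc k) (λ y → collinear (L x y) u v)   ≡⟨ cong (k *_) (sum-permute (suc k) (L x) (rows x) (λ s → collinear s u v)) ⟩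
      k * sumFin (suc k) (λ s → collinear s u v)         ∎
    by-group : Dec (x ≡ z) → Dec (u ≡ v) →
      sumFin (suc k) (λ y → meet (L x y) (L z y) u v) ≡ GDDRhs (k * suc k) k (suc k) (x , u) (z , v)
    by-group (no x≢z) _ = begin
      sumFin (suc k) (λ y → meet (L x y) (L z y) u v) ≡⟨ sum-ones (suc k) (λ y → meet-distinct (columns-differ x≢z y) u v) ⟩
      suc k                                           ≡⟨ GDDRhs-other-group (k * suc k) k (suc k) u v x≢z ⟨
      GDDRhs (k * suc k) k (suc k) (x , u) (z , v)    ∎
    by-group (yes refl) (yes refl) = begin
      sumFin (suc k) (λ y → meet (L x y) (L x y) u u) ≡⟨ row-sum ⟩
      k * sumFin (suc k) (λ s → collinear s u u)      ≡⟨ cong (k *_) (collinear-diagonal u) ⟩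
      k * suc k                                       ≡⟨ GDDRhs-diagonal (k * suc k) k (suc k) x u ⟨
      GDDRhs (k * suc k) k (suc k) (x , u) (x , u)    ∎
    by-group (yes refl) (no u≢v) = begin
      sumFin (suc k) (λ y → meet (L x y) (L x y) u v) ≡⟨ row-sum ⟩
      k * sumFin (suc k) (λ s → collinear s u v)      ≡⟨ cong (k *_) (collinear-off-diagonal u≢v) ⟩
      k * 1                                           ≡⟨ *-identityʳ k ⟩
      k                                               ≡⟨ GDDRhs-same-group (k * suc k) k (suc k) x u≢v ⟨
      GDDRhs (k * suc k) k (suc k) (x , u) (x , v)    ∎

  block-SGDD : ∀ L → IsLatin (suc k) L → IsSGDD (suc k) n (k * suc k) k (suc k) (block L)
  block-SGDD L latin = block-zeroOne L , gram , gram-transpose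
    where
    gram : ∀ p q → mul (block L) (transpose (block L)) p q ≡ GDDRhs (k * suc k) k (suc k) p q
    gram (x , u) (z , v) = gram-latin L latin x z u v
    gram-transpose : ∀ p q → mul (transpose (block L)) (block L) p q ≡ GDDRhs (k * suc k) k (suc k) p q
    gram-transpose (x , u) (z , v) = trans
      (sum-cong (suc k) (λ y → sum-cong n (λ w → cong₂ _*_ (collinear-sym (L y x) w u) (collinear-sym (L y z) w v))))
      (gram-latin (λ a b → L b a) (swap latin) x z u v)

  block-mul : ∀ L M K → (∀ x z → count (suc k) (λ y → eqB (L x y) (M y z)) ≡ 1) →
    (∀ x y z → L x y ≡ M y z → K x z ≡ L x y) →
    ∀ p q → mul (block L) (block M) p q ≡ k * block K p q + k
  block-mul L M K unique-match K-match (x , u) (z , v) = +-cancelʳ-≡ 1 _ _ (begin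
    mul (block L) (block M) (x , u) (z , v) + 1        ≡⟨ cong (_+ 1) (sum-cong (suc k) (λ y → sum-cong n (λ w →
                                                            cong (collinear (L x y) u w *_) (collinear-sym (M y z) w v)))) ⟩
    sumFin (suc k) (λ y → meet (L x y) (M y z) u v) + 1 ≡⟨ sum-one-exception (suc k) _ _ _ (unique-match x z) match mismatch ⟩
    k * collinear (K x z) u v + suc k                  ≡⟨ +-suc _ k ⟩
    suc (k * collinear (K x z) u v + k)                ≡⟨ +-comm 1 _ ⟩
    k * collinear (K x z) u v + k + 1                  ∎)
    where
    match : ∀ y → eqB (L x y) (M y z) ≡ true → meet (L x y) (M y z) u v ≡ k * collinear (K x z) u v
    match y e = begin
      meet (L x y) (M y z) u v   ≡⟨ cong (λ s → meet (L x y) s u v) (sym (eqB-true e)) ⟩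
      meet (L x y) (L x y) u v   ≡⟨ meet-self (L x y) u v ⟩
      k * collinear (L x y) u v  ≡⟨ cong (λ s → k * collinear s u v) (sym (K-match x y z (eqB-true e))) ⟩
      k * collinear (K x z) u v  ∎
    mismatch : ∀ y → eqB (L x y) (M y z) ≡ false → meet (L x y) (M y z) u v ≡ 1
    mismatch y e = meet-distinct (λ Lxy≡Myz → not-¬ e (eqB-≡ Lxy≡Myz)) u v

-- The affine plane of a generalized Hadamard matrix

module GeneralizedHadamard {g} (plus : Op₂ (Fin g)) (zero# : Fin g) (minus : Op₁ (Fin g))
  (isAbelianGroup : IsAbelianGroup _≡_ plus zero# minus)
  (H : Fin g → Fin g → Fin g) (isGH : IsGH1 g plus minus H) where

  G : AbelianGroup 0ℓ 0ℓ
  G = record { isAbelianGroup = isAbelianGroup }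

  open AbelianGroup G using (_∙_; _⁻¹; _-_; assoc; comm; commutativeSemigroup)
  open AbelianGroupProperties G using (∙-cancelʳ; //-rightDividesˡ; //-rightDividesʳ;
    x∙y⁻¹≈ε⇒x≈y; x≈y⇒x∙y⁻¹≈ε; ⁻¹-anti-homo‿-)
  open CommutativeSemigroupProperties commutativeSemigroup using (interchange)

  -‿cancelʳ : ∀ {x y} h → x - h ≡ y - h → x ≡ y
  -‿cancelʳ {x} {y} h = ∙-cancelʳ (h ⁻¹) x y

  -≡⇔≡∙ : ∀ x h y → (x - h ≡ y) ⇔ (x ≡ y ∙ h)
  -≡⇔≡∙ x h y = mk⇔ (λ x-h≡y → trans (sym (//-rightDividesˡ h x)) (cong (_∙ h) x-h≡y))
                    (λ x≡y∙h → trans (cong (_- h) x≡y∙h) (//-rightDividesʳ h y))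

  -‿interchange : ∀ x y x' y' → (x - x') - (y - y') ≡ (x - y) - (x' - y')
  -‿interchange x y x' y' = begin
    (x - x') - (y - y')                ≡⟨ cong ((x - x') ∙_) (⁻¹-anti-homo‿- y y') ⟩
    (x ∙ x' ⁻¹) ∙ (y' ∙ y ⁻¹)          ≡⟨ interchange x (x' ⁻¹) y' (y ⁻¹) ⟩
    (x ∙ y') ∙ (x' ⁻¹ ∙ y ⁻¹)          ≡⟨ cong ((x ∙ y') ∙_) (comm (x' ⁻¹) (y ⁻¹)) ⟩
    (x ∙ y') ∙ (y ⁻¹ ∙ x' ⁻¹)          ≡⟨ interchange x (y ⁻¹) y' (x' ⁻¹) ⟨
    (x ∙ y ⁻¹) ∙ (y' ∙ x' ⁻¹)          ≡⟨ cong ((x - y) ∙_) (⁻¹-anti-homo‿- x' y') ⟨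
    (x - y) - (x' - y')                ∎

  -‿swap : ∀ {x y x' y'} → x - y ≡ x' - y' → x - x' ≡ y - y'
  -‿swap {x} {y} {x'} {y'} e =
    x∙y⁻¹≈ε⇒x≈y (x - x') (y - y') (trans (-‿interchange x y x' y') (x≈y⇒x∙y⁻¹≈ε e))

  -‿swap-⇔ : ∀ x y x' y' → (x - y ≡ x' - y') ⇔ (y - y' ≡ x - x')
  -‿swap-⇔ x y x' y' = mk⇔ (λ e → sym (-‿swap e)) (λ e → -‿swap (sym e))

  ∙-≡⇔-≡- : ∀ x h h' y → ((x ∙ h) - h' ≡ y) ⇔ (h - h' ≡ y - x)
  ∙-≡⇔-≡- x h h' y = mk⇔
    (λ e → sym (Equivalence.from (-≡⇔≡∙ y x (h - h')) (trans (sym e) reassociate)))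
    (λ e → trans reassociate (sym (Equivalence.to (-≡⇔≡∙ y x (h - h')) (sym e))))
    where
    reassociate : (x ∙ h) - h' ≡ (h - h') ∙ x
    reassociate = trans (assoc x h (h' ⁻¹)) (comm x (h - h'))

  isGH-transpose : IsGH1 g _∙_ _⁻¹ (λ a r → H r a)
  isGH-transpose a a' a≢a' = sum-≤1-saturated g hits hits≤1 total
    where
    hits : Fin g → ℕ
    hits x = count g (λ r → eqB (H r a - H r a') x)
    same-difference⇒same-row : ∀ r r' → H r a - H r a' ≡ H r' a - H r' a' → r ≡ r'
    same-difference⇒same-row r r' e with r Fin.≟ r'
    ... | yes r≡r' = r≡r'
    ... | no r≢r' = ⊥-elim (a≢a' (count-unique g _ (isGH r r' r≢r' (H r a - H r' a))
                                   (eqB-refl (H r a - H r' a)) (eqB-≡ (sym (-‿swap e)))))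
    hits≤1 : ∀ x → hits x ≤ 1
    hits≤1 x = count-≤1 g _ (λ {r} {r'} rx r'x → same-difference⇒same-row r r' (trans (eqB-true rx) (sym (eqB-true r'x))))
    total : sumFin g hits ≡ g
    total = trans (sum-count-fibres g g (λ _ → true) (λ r → H r a - H r a')) (count-true g)

  line : Fin (suc g) → Fin g × Fin g → Fin g
  line zero    (a , b) = a
  line (suc r) (a , b) = b - H r a

  shifts-bijective : ∀ h y → count g (λ b → eqB (b - h) y) ≡ 1
  shifts-bijective h y = trans (count-cong g (λ b → eqB-cong (-≡⇔≡∙ b h y))) (count-≡ g (y ∙ h))

  lines-meet : ∀ s t → s ≢ t → ∀ x y →
    sumFin g (λ a → count g (λ b → eqB (line s (a , b)) x ∧ eqB (line t (a , b)) y)) ≡ 1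
  lines-meet zero zero s≢t = ⊥-elim (s≢t refl)
  lines-meet zero (suc r) _ x y = begin
    sumFin g (λ a → count g (λ b → eqB a x ∧ eqB (b - H r a) y))  ≡⟨ sum-cong g (λ a → count-∧ˡ g (eqB a x) _) ⟩
    sumFin g (λ a → ind (eqB a x) * count g (λ b → eqB (b - H r a) y)) ≡⟨ sum-δ g x _ ⟩
    count g (λ b → eqB (b - H r x) y)                              ≡⟨ shifts-bijective (H r x) y ⟩
    1                                                              ∎
  lines-meet (suc r) zero s≢t x y =
    trans (sum-cong g (λ a → count-cong g (λ b → ∧-comm (eqB (line (suc r) (a , b)) x) (eqB a y))))
          (lines-meet zero (suc r) (λ ()) y x)
  lines-meet (suc r) (suc r') s≢t x y = begin
    sumFin g (λ a → count g (λ b → eqB (b - H r a) x ∧ eqB (b - H r' a) y))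
      ≡⟨ sum-cong g (λ a → count-cong g (λ b → cong (_∧ eqB (b - H r' a) y) (eqB-cong (-≡⇔≡∙ b (H r a) x)))) ⟩
    sumFin g (λ a → count g (λ b → eqB b (x ∙ H r a) ∧ eqB (b - H r' a) y))
      ≡⟨ sum-cong g (λ a → count-δ g (x ∙ H r a) (λ b → eqB (b - H r' a) y)) ⟩
    sumFin g (λ a → ind (eqB ((x ∙ H r a) - H r' a) y))
      ≡⟨ sum-cong g (λ a → cong ind (eqB-cong (∙-≡⇔-≡- x (H r a) (H r' a) y))) ⟩
    sumFin g (λ a → ind (eqB (H r a - H r' a) (y - x)))
      ≡⟨ count≡sum g _ ⟨
    count g (λ a → eqB (H r a - H r' a) (y - x))
      ≡⟨ isGH r r' (λ r≡r' → s≢t (cong suc r≡r')) (y - x) ⟩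
    1 ∎

  unique-line : ∀ {p q} → p ≢ q → count (suc g) (λ s → eqB (line s p) (line s q)) ≡ 1
  unique-line {a , b} {a' , b'} p≢q = by-column (a Fin.≟ a')
    where
    by-column : Dec (a ≡ a') → ind (eqB a a') + count g (λ r → eqB (b - H r a) (b' - H r a')) ≡ 1
    by-column (yes refl) = cong₂ _+_ (cong ind (eqB-refl a))
      (count-false g (λ r → eqB-≢ (λ e → p≢q (cong (a ,_) (-‿cancelʳ (H r a) e)))))
    by-column (no a≢a') = cong₂ _+_ (cong ind (eqB-≢ a≢a'))
      (trans (count-cong g (λ r → eqB-cong (-‿swap-⇔ b (H r a) b' (H r a'))))
             (isGH-transpose a a' a≢a' (b - b')))

  point : Fin (g * g) → Fin g × Fin g
  point = remQuot g

  point-injective : ∀ {u v} → point u ≡ point v → u ≡ v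
  point-injective {u} {v} e =
    trans (sym (Fin.combine-remQuot {g} g u)) (trans (cong (uncurry combine) e) (Fin.combine-remQuot {g} g v))

  affinePlane : IsAffinePlane (g * g) g (λ s w → line s (point w))
  affinePlane = record
    { lines-meet  = λ s t s≢t x y →
        trans (count-remQuot g g (λ p → eqB (line s p) x ∧ eqB (line t p) y)) (lines-meet s t s≢t x y)
    ; unique-line = λ u v u≢v → unique-line (λ e → u≢v (point-injective e))
    }

-- Linked UFS Latin squares

third-index : ∀ {f} → 3 ≤ f → (i j : Fin f) → ∃ λ k → i ≢ k × j ≢ k
third-index (s≤s (s≤s (s≤s _))) zero          zero          = suc zero , (λ ()) , (λ ())
third-index (s≤s (s≤s (s≤s _))) zero          (suc zero)    = suc (suc zero) , (λ ()) , (λ ())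
third-index (s≤s (s≤s (s≤s _))) zero          (suc (suc _)) = suc zero , (λ ()) , (λ ())
third-index (s≤s (s≤s (s≤s _))) (suc zero)    zero          = suc (suc zero) , (λ ()) , (λ ())
third-index (s≤s (s≤s (s≤s _))) (suc zero)    (suc _)       = zero , (λ ()) , (λ ())
third-index (s≤s (s≤s (s≤s _))) (suc (suc _)) zero          = suc zero , (λ ()) , (λ ())
third-index (s≤s (s≤s (s≤s _))) (suc (suc _)) (suc _)       = zero , (λ ()) , (λ ())

module LinkedUFSProperties {f N L} (linked : LinkedUFS f N L) where
  private
    ufs = proj₂ (proj₂ linked)

  linked-transpose : ∀ {i j} → i ≢ j → ∀ x y → L j i y x ≡ L i j x y
  linked-transpose {i} {j} i≢j x y = begin
    L j i y x ≡⟨ proj₂ (ufs j i k (j≢i , i≢k , j≢k)) y x a (sym Lika≡Ljka) ⟩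
    L j k y a ≡⟨ Lika≡Ljka ⟨
    L i k x a ≡⟨ proj₂ (ufs i j k (i≢j , j≢k , i≢k)) x y a Lika≡Ljka ⟨
    L i j x y ∎
    where
    k = proj₁ (third-index (proj₁ linked) i j)
    i≢k = proj₁ (proj₂ (third-index (proj₁ linked) i j))
    j≢k = proj₂ (proj₂ (third-index (proj₁ linked) i j))
    j≢i : j ≢ i
    j≢i j≡i = i≢j (sym j≡i)
    witness = count-witness N _ (proj₁ (ufs i j k (i≢j , j≢k , i≢k)) x y)
    a = proj₁ witness
    Lika≡Ljka : L i k x a ≡ L j k y a
    Lika≡Ljka = eqB-true (proj₂ witness)

  match-unique : ∀ {i j l} → Distinct3 i j l → ∀ x z → count N (λ y → eqB (L i j x y) (L j l y z)) ≡ 1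
  match-unique {i} {j} {l} (i≢j , j≢l , i≢l) x z =
    trans (count-cong N (λ y → cong (eqB (L i j x y)) (linked-transpose (λ l≡j → j≢l (sym l≡j)) z y)))
          (proj₁ (ufs i l j (i≢l , (λ l≡j → j≢l (sym l≡j)) , i≢j)) x z)

  match-value : ∀ {i j l} → Distinct3 i j l → ∀ x y z → L i j x y ≡ L j l y z → L i l x z ≡ L i j x y
  match-value {i} {j} {l} (i≢j , j≢l , i≢l) x y z Lijxy≡Ljlyz =
    proj₂ (ufs i l j (i≢l , (λ l≡j → j≢l (sym l≡j)) , i≢j)) x z y
      (trans Lijxy≡Ljlyz (linked-transpose (λ l≡j → j≢l (sym l≡j)) z y))

linked-constants : ∀ k {a} → a ≡ 0 ⊎ a ≡ 1 → k * a + k ≡ 2 * k * a + k * (1 ∸ a)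
linked-constants k (inj₁ refl) = arith k
  where
  arith : ∀ k → k * 0 + k ≡ 2 * k * 0 + k * 1
  arith = solve-∀
linked-constants k (inj₂ refl) = arith k
  where
  arith : ∀ k → k * 1 + k ≡ 2 * k * 1 + k * 0
  arith = solve-∀

theorem5p9 : (g f : ℕ) (_+_ : Op₂ (Fin g)) (0# : Fin g) (-_ : Op₁ (Fin g)) →
    IsAbelianGroup _≡_ _+_ 0# -_ →
    (H : Fin g → Fin g → Fin g) → IsGH1 g _+_ -_ H →
    (L : Fin f → Fin f → Square (suc g)) → LinkedUFS f (suc g) L →
    ∃ λ (A : Fin f → Fin f → Mat (suc g) (g * g)) →
      LinkedSGDD f (suc g) (g * g) (g * suc g) g (suc g) (2 * g) g A
theorem5p9 g f plus zero# minus isAbelianGroup H isGH L linked =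
  (λ i j → block (L i j)) , designs , transposes , products
  where
  open AffinePlane (GeneralizedHadamard.affinePlane plus zero# minus isAbelianGroup H isGH)
  open LinkedUFSProperties linked

  designs : ∀ i j → i ≢ j → IsSGDD (suc g) (g * g) (g * suc g) g (suc g) (block (L i j))
  designs i j i≢j = block-SGDD (L i j) (proj₁ (proj₂ linked) i j i≢j)

  transposes : ∀ i j → i ≢ j → ∀ p q → transpose (block (L i j)) p q ≡ block (L j i) p q
  transposes i j i≢j = block-transpose (L i j) (L j i) (λ x z → linked-transpose i≢j z x)

  products : ∀ i j l → Distinct3 i j l → ∀ p q →
    mul (block (L i j)) (block (L j l)) p q ≡ 2 * g * block (L i l) p q + g * (1 ∸ block (L i l) p q)
  products i j l d p q = trans (block-mul (L i j) (L j l) (L i l) (match-unique d) (match-value d) p q)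
                               (linked-constants g (block-zeroOne (L i l) p q))
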